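{- For every integer $n > 2$ there exist two pedigrees $\mathcal{T}(X_0)$ and $\mathcal{U}(X_0)$ on the same extant set $X_0$ with $|X_0| = n$ such that $\mathcal{T}(X_0)$ and $\mathcal{U}(X_0)$ are $(n-1)$-hypomorphic but not isomorphic (i.e. there is no isomorphism from $\mathcal{T}(X_0)$ to $\mathcal{U}(X_0)$ fixing every vertex of $X_0$).
   Context: A (general) pedigree $\mathcal{T}(X_0)$ on a set $X_0$ is a finite directed graph (no loops, no multiple arcs) on a vertex set $V$ such that: every vertex has out-degree $0$ or $2$; $X_0 \subseteq V$ and every vertex of $X_0$ has in-degree $0$; there are no isolated vertices. Vertices of $X_0$ are called extant; $|X_0|$ is the order of the pedigree. If $uv$ is an arc, $v$ is a parent of $u$. A vertex $v$ is a descendant of $u$ if there is a directed path from $v$ to $u$ (every vertex is its own descendant). For $Y \subseteq X_0$, the sub-pedigree $\mathcal{T}(Y)$ is obtained from $\mathcal{T}(X_0)$ by deleting every vertex that has no descendant in $Y$. An isomorphism between two pedigrees with extant sets containing a common labelled set $Y$ is a bijection of vertex sets preserving arcs in both directions and fixing every vertex of $Y$ (the non-extant vertices are unlabelled). For $1 \le r < n$, two pedigrees $\mathcal{T}(X_0)$ and $\mathcal{U}(X_0)$ of order $n$ are $r$-hypomorphic if for every $Y \subseteq X_0$ with $|Y| = r$ there is an isomorphism from $\mathcal{T}(Y)$ to $\mathcal{U}(Y)$ fixing every vertex of $Y$. -}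

module Defs where

open import Data.Nat using (ℕ)
open import Data.Fin using (Fin)
open import Data.Fin.Subset using (Subset; _∈_)
open import Data.Bool using (Bool; true)
open import Data.Product using (Σ; ∃; _×_; _,_)
open import Data.Sum using (_⊎_)
open import Data.Empty using (⊥)
open import Relation.Nullary using (¬_)
open import Relation.Binary.PropositionalEquality using (_≡_; _≢_)
open import Relation.Binary.Construct.Closure.ReflexiveTransitive using (Star)
open import Function.Definitions using (Injective)

-- Arcs: adjacency matrix (so no multiple arcs);
-- an arc u → v means v is a parent of u.
record Pedigree (n : ℕ) : Set where
  field
    m       : ℕ
    adj     : Fin m → Fin m → Bool
    ext     : Fin n → Fin m
    ext-inj : Injective _≡_ _≡_ ext
  Arc : Fin m → Fin m → Set
  Arc u v = adj u v ≡ true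
  field
    noLoop    : ∀ v → ¬ Arc v v
    outDeg    : ∀ u → (∀ v → ¬ Arc u v)
                      ⊎ (Σ (Fin m) λ p → Σ (Fin m) λ q →
                           p ≢ q × Arc u p × Arc u q × (∀ v → Arc u v → v ≡ p ⊎ v ≡ q))
    extInDeg0 : ∀ i u → ¬ Arc u (ext i)
    noIsolated : ∀ v → (∃ λ w → Arc v w) ⊎ (∃ λ w → Arc w v)

open Pedigree public

Descendant : ∀ {n} (T : Pedigree n) → Fin (m T) → Fin (m T) → Set
Descendant T v u = Star (Arc T) v u

-- vertex w survives in the sub-pedigree T(Y): it has a descendant in Y
InSub : ∀ {n} (T : Pedigree n) → Subset n → Fin (m T) → Set
InSub T Y w = Σ (Fin _) λ y → y ∈ Y × Descendant T (ext T y) w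

-- An isomorphism from T(Y) to U(Y) fixing every vertex of Y:
-- a bijection between the vertex sets of the two sub-pedigrees
-- (given by mutually inverse maps f, g on the surviving vertices)
-- preserving arcs in both directions and fixing the labelled vertices of Y.
record SubIso {n} (T U : Pedigree n) (Y : Subset n) : Set where
  field
    f     : Fin (m T) → Fin (m U)
    g     : Fin (m U) → Fin (m T)
    f-in  : ∀ w → InSub T Y w → InSub U Y (f w)
    g-in  : ∀ w → InSub U Y w → InSub T Y (g w)
    gf    : ∀ w → InSub T Y w → g (f w) ≡ w
    fg    : ∀ w → InSub U Y w → f (g w) ≡ w
    arc→  : ∀ u v → InSub T Y u → InSub T Y v → Arc T u v → Arc U (f u) (f v)
    arc←  : ∀ u v → InSub T Y u → InSub T Y v → Arc U (f u) (f v) → Arc T u v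
    fixY  : ∀ y → y ∈ Y → f (ext T y) ≡ ext U y

Hypomorphic : ∀ {n} → ℕ → Pedigree n → Pedigree n → Set
Hypomorphic {n} r T U = ∀ (Y : Subset n) → Data.Fin.Subset.∣ Y ∣ ≡ r → SubIso T U Y

module Submission where

-- Both pedigrees are ladders closed up into a cycle of n ≥ 3 rungs. Each extant vertex j has
-- two parents, one on each of two sheets, and the parent on sheet s over rung j has one
-- grandparent over rung j and one over the next rung, on the same sheet except where the
-- ladder is twisted.  T is twisted across one rung (a Möbius band), U nowhere (a cylinder).
-- An isomorphism fixing the extant vertices permutes the two parents over each rung; reading
-- off these permutations and following them once around the cycle shows that the parity of
-- the number of twists is invariant, so T ≇ U.  Deleting an extant vertex k cuts the cycle
-- at rung k, and exchanging the two sheets over every rung after k moves the twist of T to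
-- the cut, where it is invisible: this gives the isomorphisms of all (n-1)-sub-pedigrees.
-- The length n ≥ 3 keeps the rungs j, next j and next (next j) distinct.

open import Defs
open import Data.Nat using (ℕ; _<_; _∸_)
open import Data.Fin.Subset using (⊤)
open import Data.Product using (Σ; _×_)
open import Relation.Nullary using (¬_)

open import Data.Nat using (suc; _+_; _*_; _≤_; s≤s; z≤n)
open import Data.Bool using (Bool; true; false; not; _xor_)
open import Data.Bool.Properties using (xor-assoc; xor-same; xor-identityʳ; not-¬; ¬-not)
import Data.Bool.Properties as Bool
open import Data.Fin using (Fin; zero; suc; toℕ; fromℕ; inject₁)
open import Data.Fin.Induction using (<-weakInduction)
open import Data.Fin.Patterns using (0F; 1F; 2F; 3F; 4F)
open import Data.Fin.Properties
  using ( *↔×; ¬∀⟶∃¬; ≤fromℕ; ≤∧≢⇒<; <⇒≤pred; ≤̄⇒inject₁<; <-trans; ≤-refl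
        ; toℕ-inject₁; toℕ-fromℕ; fromℕ≢inject₁)
  renaming (_<?_ to _<ᶠ?_; _≟_ to _≟ᶠ_)
open import Data.Fin.Relation.Unary.Top using (View; view; ‵fromℕ; ‵inject₁; view-fromℕ; view-inject₁)
open import Data.Fin.Subset using (Subset; _∈_; _∉_; ∣_∣)
open import Data.Fin.Subset.Properties using (_∈?_; ∈⊤; p⊆q⇒∣p∣≤∣q∣; ∣⊤∣≡n)
import Data.Nat.Properties as ℕ
open import Data.Product using (∃; _,_; proj₁; proj₂)
open import Data.Sum using (_⊎_; inj₁; inj₂)
import Data.Sum as Sum
open import Data.Unit using (tt) renaming (⊤ to Unit)
open import Function using (_∘_; mk⇔; _↔_; mk↔ₛ′; Inverse)
open import Function.Definitions using (Injective)
open import Function.Properties.Inverse using (↔-trans; ↔-sym)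
open import Relation.Binary.Definitions using (Decidable)
open import Relation.Binary.PropositionalEquality
open import Relation.Binary.Construct.Closure.ReflexiveTransitive using (Star; ε; _◅_; gmap)
open import Relation.Nullary using (yes; no; does; contradiction)
open import Relation.Nullary.Decidable using (dec-true; dec-false; does-⇔; _×-dec_)

record PedigreeOn (n : ℕ) (V : Set) : Set₁ where
  field
    extant           : Fin n → V
    extant-injective : Injective _≡_ _≡_ extant
    Parent           : V → V → Set      -- Parent u v: v is a parent of u
    parent?          : Decidable Parent
    parent-irrefl    : ∀ v → ¬ Parent v v
    parents          : ∀ u → (∀ v → ¬ Parent u v)
                             ⊎ (Σ V λ p → Σ V λ q →
                                  p ≢ q × Parent u p × Parent u q × (∀ v → Parent u v → v ≡ p ⊎ v ≡ q))
    extant-childless : ∀ i u → ¬ Parent u (extant i)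
    not-isolated     : ∀ v → (∃ λ w → Parent v w) ⊎ (∃ λ w → Parent w v)

open PedigreeOn

HasDescendantIn : ∀ {n V} → PedigreeOn n V → Subset n → V → Set
HasDescendantIn P Y v = Σ (Fin _) λ y → y ∈ Y × Star (Parent P) (extant P y) v

record SubIsoOn {n V} (P Q : PedigreeOn n V) (Y : Subset n) : Set where
  field
    f     : V → V
    g     : V → V
    f-in  : ∀ v → HasDescendantIn P Y v → HasDescendantIn Q Y (f v)
    g-in  : ∀ v → HasDescendantIn Q Y v → HasDescendantIn P Y (g v)
    gf    : ∀ v → HasDescendantIn P Y v → g (f v) ≡ v
    fg    : ∀ v → HasDescendantIn Q Y v → f (g v) ≡ v
    arc→  : ∀ u v → HasDescendantIn P Y u → HasDescendantIn P Y v → Parent P u v → Parent Q (f u) (f v)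
    arc←  : ∀ u v → HasDescendantIn P Y u → HasDescendantIn P Y v → Parent Q (f u) (f v) → Parent P u v
    fixY  : ∀ y → y ∈ Y → f (extant P y) ≡ extant Q y

module Enumerated {V : Set} {m : ℕ} (enum : V ↔ Fin m) where
  open Inverse enum using (to; from; strictlyInverseˡ; strictlyInverseʳ; inverseˡ)

  to-injective : Injective _≡_ _≡_ to
  to-injective {a} {b} e = trans (sym (strictlyInverseʳ a)) (trans (cong from e) (strictlyInverseʳ b))

  module _ {n : ℕ} (P : PedigreeOn n V) where
    Adj : Fin m → Fin m → Set
    Adj u v = does (parent? P (from u) (from v)) ≡ true

    adj⇒parent : ∀ {u v} → Adj u v → Parent P (from u) (from v)
    adj⇒parent {u} {v} e with parent? P (from u) (from v) | e
    ... | yes p | _  = p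
    ... | no _  | ()

    parent⇒adj : ∀ {u v} → Parent P (from u) (from v) → Adj u v
    parent⇒adj {u} {v} = dec-true (parent? P (from u) (from v))

    parent⇒adj-to : ∀ {a b} → Parent P a b → Adj (to a) (to b)
    parent⇒adj-to {a} {b} p = parent⇒adj (subst₂ (Parent P) (sym (strictlyInverseʳ a)) (sym (strictlyInverseʳ b)) p)

    adj-to⇒parent : ∀ {a b} → Adj (to a) (to b) → Parent P a b
    adj-to⇒parent {a} {b} e = subst₂ (Parent P) (strictlyInverseʳ a) (strictlyInverseʳ b) (adj⇒parent e)

  toPedigree : ∀ {n} → PedigreeOn n V → Pedigree n
  toPedigree P = record
    { m          = m
    ; adj        = λ u v → does (parent? P (from u) (from v))
    ; ext        = to ∘ extant P
    ; ext-inj    = extant-injective P ∘ to-injective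
    ; noLoop     = λ v → parent-irrefl P (from v) ∘ adj⇒parent P
    ; outDeg     = parents-adj
    ; extInDeg0  = λ i u a → extant-childless P i (from u)
                     (subst (Parent P (from u)) (strictlyInverseʳ (extant P i)) (adj⇒parent P a))
    ; noIsolated = adjacent-somewhere
    }
    where
    from≡⇒≡to : ∀ {u a} → from u ≡ a → u ≡ to a
    from≡⇒≡to e = sym (inverseˡ (sym e))

    parent⇒adj-from : ∀ {u a} → Parent P (from u) a → Adj P u (to a)
    parent⇒adj-from {u} {a} p = parent⇒adj P (subst (Parent P (from u)) (sym (strictlyInverseʳ a)) p)

    parent⇒adj-into : ∀ {a u} → Parent P a (from u) → Adj P (to a) u
    parent⇒adj-into {a} {u} p = parent⇒adj P (subst (λ z → Parent P z (from u)) (sym (strictlyInverseʳ a)) p)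

    parents-adj : ∀ u → (∀ v → ¬ Adj P u v) ⊎ (Σ (Fin m) λ p → Σ (Fin m) λ q →
               p ≢ q × Adj P u p × Adj P u q × (∀ v → Adj P u v → v ≡ p ⊎ v ≡ q))
    parents-adj u with parents P (from u)
    ... | inj₁ none = inj₁ λ v → none (from v) ∘ adj⇒parent P
    ... | inj₂ (p , q , p≢q , up , uq , only) =
      inj₂ (to p , to q , p≢q ∘ to-injective , parent⇒adj-from up , parent⇒adj-from uq ,
            λ v → Sum.map from≡⇒≡to from≡⇒≡to ∘ only (from v) ∘ adj⇒parent P)

    adjacent-somewhere : ∀ v → (∃ λ w → Adj P v w) ⊎ (∃ λ w → Adj P w v)
    adjacent-somewhere v with not-isolated P (from v)
    ... | inj₁ (w , vw) = inj₁ (to w , parent⇒adj-from vw)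
    ... | inj₂ (w , wv) = inj₂ (to w , parent⇒adj-into wv)

  module _ {n : ℕ} (P : PedigreeOn n V) where
    inSub⁺ : ∀ {Y v} → HasDescendantIn P Y v → InSub (toPedigree P) Y (to v)
    inSub⁺ (y , y∈Y , path) = y , y∈Y , gmap to (parent⇒adj-to P) path

    inSub⁻ : ∀ {Y w} → InSub (toPedigree P) Y w → HasDescendantIn P Y (from w)
    inSub⁻ (y , y∈Y , path) =
      y , y∈Y , subst (λ z → Star (Parent P) z _) (strictlyInverseʳ (extant P y)) (gmap from (adj⇒parent P) path)

  module _ {n : ℕ} {P Q : PedigreeOn n V} {Y : Subset n} where
    SubIsoOn⇒SubIso : SubIsoOn P Q Y → SubIso (toPedigree P) (toPedigree Q) Y
    SubIsoOn⇒SubIso φ = record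
      { f     = to ∘ f ∘ from
      ; g     = to ∘ g ∘ from
      ; f-in  = λ w → inSub⁺ Q ∘ f-in (from w) ∘ inSub⁻ P
      ; g-in  = λ w → inSub⁺ P ∘ g-in (from w) ∘ inSub⁻ Q
      ; gf    = λ w s → round-trip {h = f} {k = g} gf (inSub⁻ P s)
      ; fg    = λ w s → round-trip {h = g} {k = f} fg (inSub⁻ Q s)
      ; arc→  = λ u v su sv → parent⇒adj-to Q ∘ arc→ (from u) (from v) (inSub⁻ P su) (inSub⁻ P sv) ∘ adj⇒parent P
      ; arc←  = λ u v su sv → parent⇒adj P ∘ arc← (from u) (from v) (inSub⁻ P su) (inSub⁻ P sv) ∘ adj-to⇒parent Q
      ; fixY  = λ y y∈Y → cong to (trans (cong f (strictlyInverseʳ (extant P y))) (fixY y y∈Y))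
      }
      where
      open SubIsoOn φ
      round-trip : ∀ {R : V → Set} {h k : V → V} → (∀ v → R v → k (h v) ≡ v)
                 → ∀ {w} → R (from w) → to (k (from (to (h (from w))))) ≡ w
      round-trip {k = k} kh {w} r =
        trans (cong (to ∘ k) (strictlyInverseʳ _)) (trans (cong to (kh (from w) r)) (strictlyInverseˡ w))

    SubIso⇒SubIsoOn : SubIso (toPedigree P) (toPedigree Q) Y → SubIsoOn P Q Y
    SubIso⇒SubIsoOn φ = record
      { f     = from ∘ f ∘ to
      ; g     = from ∘ g ∘ to
      ; f-in  = λ v → inSub⁻ Q ∘ f-in (to v) ∘ inSub⁺ P
      ; g-in  = λ v → inSub⁻ P ∘ g-in (to v) ∘ inSub⁺ Q
      ; gf    = λ v s → round-trip {h = f} {k = g} gf (inSub⁺ P s)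
      ; fg    = λ v s → round-trip {h = g} {k = f} fg (inSub⁺ Q s)
      ; arc→  = λ u v su sv → adj⇒parent Q ∘ arc→ (to u) (to v) (inSub⁺ P su) (inSub⁺ P sv) ∘ parent⇒adj-to P
      ; arc←  = λ u v su sv → adj-to⇒parent P ∘ arc← (to u) (to v) (inSub⁺ P su) (inSub⁺ P sv) ∘ parent⇒adj Q
      ; fixY  = λ y y∈Y → trans (cong from (fixY y y∈Y)) (strictlyInverseʳ (extant Q y))
      }
      where
      open SubIso φ
      round-trip : ∀ {R : Fin m → Set} {h k : Fin m → Fin m} → (∀ w → R w → k (h w) ≡ w)
                 → ∀ {v} → R (to v) → from (k (to (from (h (to v))))) ≡ v
      round-trip {k = k} kh {v} r =
        trans (cong (from ∘ k) (strictlyInverseˡ _)) (trans (cong from (kh (to v) r)) (strictlyInverseʳ v))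

module _ {n : ℕ} {V : Set} {P Q : PedigreeOn n V} {Y : Subset n}
  (Good : V → Set) (φ : V → V)
  (good-extant  : ∀ y → y ∈ Y → Good (extant P y))
  (good-parentᴾ : ∀ {u v} → Good u → Parent P u v → Good v)
  (good-parentᵠ : ∀ {u v} → Good u → Parent Q u v → Good v)
  (good-φ       : ∀ {u} → Good u → Good (φ u))
  (φ-involutive : ∀ v → φ (φ v) ≡ v)
  (φ-extant     : ∀ y → φ (extant P y) ≡ extant Q y)
  (φ-parentᴾ    : ∀ {u v} → Good u → Parent P u v → Parent Q (φ u) (φ v))
  (φ-parentᵠ    : ∀ {u v} → Good u → Parent Q u v → Parent P (φ u) (φ v))
  where

  private
    good-ancestor : ∀ {R : V → V → Set} → (∀ {u v} → Good u → R u v → Good v)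
                  → ∀ {a b} → Good a → Star R a b → Good b
    good-ancestor closed ga ε        = ga
    good-ancestor closed ga (r ◅ rs) = good-ancestor closed (closed ga r) rs

    φ-ancestor : ∀ {R S : V → V → Set} → (∀ {u v} → Good u → R u v → Good v)
               → (∀ {u v} → Good u → R u v → S (φ u) (φ v))
               → ∀ {a b} → Good a → Star R a b → Star S (φ a) (φ b)
    φ-ancestor closed maps ga ε        = ε
    φ-ancestor closed maps ga (r ◅ rs) = maps ga r ◅ φ-ancestor closed maps (closed ga r) rs

    good-of : ∀ {v} → HasDescendantIn P Y v → Good v
    good-of (y , y∈Y , path) = good-ancestor good-parentᴾ (good-extant y y∈Y) path

    φ-extantᵠ : ∀ y → φ (extant Q y) ≡ extant P y
    φ-extantᵠ y = trans (cong φ (sym (φ-extant y))) (φ-involutive (extant P y))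

    φ-inᴾ : ∀ v → HasDescendantIn P Y v → HasDescendantIn Q Y (φ v)
    φ-inᴾ v (y , y∈Y , path) =
      y , y∈Y , subst (λ z → Star (Parent Q) z (φ v)) (φ-extant y)
                  (φ-ancestor good-parentᴾ φ-parentᴾ (good-extant y y∈Y) path)

    φ-inᵠ : ∀ v → HasDescendantIn Q Y v → HasDescendantIn P Y (φ v)
    φ-inᵠ v (y , y∈Y , path) =
      y , y∈Y , subst (λ z → Star (Parent P) z (φ v)) (φ-extantᵠ y)
                  (φ-ancestor good-parentᵠ φ-parentᵠ
                     (subst Good (φ-extant y) (good-φ (good-extant y y∈Y))) path)

  involution⇒SubIsoOn : SubIsoOn P Q Y
  involution⇒SubIsoOn = record
    { f     = φ
    ; g     = φ
    ; f-in  = φ-inᴾ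
    ; g-in  = φ-inᵠ
    ; gf    = λ v _ → φ-involutive v
    ; fg    = λ v _ → φ-involutive v
    ; arc→  = λ u v su _ → φ-parentᴾ (good-of su)
    ; arc←  = λ u v su _ → subst₂ (Parent P) (φ-involutive u) (φ-involutive v)
                             ∘ φ-parentᵠ (good-φ (good-of su))
    ; fixY  = λ y _ → φ-extant y
    }

∣p∣<n⇒∃∉ : ∀ {n} (p : Subset n) → ∣ p ∣ < n → ∃ λ x → x ∉ p
∣p∣<n⇒∃∉ {n} p ∣p∣<n = ¬∀⟶∃¬ n (_∈ p) (_∈? p) λ all∈p →
  ℕ.<-irrefl refl (ℕ.<-≤-trans ∣p∣<n
    (subst (_≤ ∣ p ∣) (∣⊤∣≡n n) (p⊆q⇒∣p∣≤∣q∣ {p = ⊤} (λ {x} _ → all∈p x))))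

next : ∀ {M} → Fin (suc M) → Fin (suc M)
next j with view j
... | ‵fromℕ     = zero
... | ‵inject₁ i = suc i

next-inject₁ : ∀ {M} (i : Fin M) → next (inject₁ i) ≡ suc i
next-inject₁ i rewrite view-inject₁ i = refl

next-fromℕ : ∀ M → next (fromℕ M) ≡ zero
next-fromℕ M rewrite view-fromℕ M = refl

next≡zero⊎toℕ-next≡suc : ∀ {M} (j : Fin (suc M))
                       → (j ≡ fromℕ M × next j ≡ zero) ⊎ toℕ (next j) ≡ suc (toℕ j)
next≡zero⊎toℕ-next≡suc {M} j = cases (view j)
  where
  cases : ∀ {j} → View j → (j ≡ fromℕ M × next j ≡ zero) ⊎ toℕ (next j) ≡ suc (toℕ j)
  cases ‵fromℕ        = inj₁ (refl , next-fromℕ _)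
  cases (‵inject₁ i) = inj₂ (trans (cong toℕ (next-inject₁ i)) (cong suc (sym (toℕ-inject₁ i))))

next≢ : ∀ {M} (j : Fin (2 + M)) → next j ≢ j
next≢ j next≡j with next≡zero⊎toℕ-next≡suc j
... | inj₁ (refl , next≡0) with () ← trans (sym next≡0) next≡j
... | inj₂ toℕ-next = ℕ.1+n≢n (trans (sym toℕ-next) (cong toℕ next≡j))

next²≢ : ∀ {M} (j : Fin (3 + M)) → next (next j) ≢ j
next²≢ j next²≡j with next≡zero⊎toℕ-next≡suc j | next≡zero⊎toℕ-next≡suc (next j)
... | inj₁ (refl , next≡0) | _ with () ← trans (sym (cong next next≡0)) next²≡j
... | inj₂ toℕ-next | inj₁ (next≡last , next²≡0)
  with refl ← trans (sym next²≡0) next²≡j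
  with () ← trans (sym toℕ-next) (trans (cong toℕ next≡last) (toℕ-fromℕ _))
... | inj₂ toℕ-next | inj₂ toℕ-next² = ℕ.m≢1+n+m (toℕ j) {1}
  (trans (cong toℕ (sym next²≡j)) (trans toℕ-next² (cong suc toℕ-next)))

module Ladder (N : ℕ) where
  n : ℕ
  n = 3 + N

  data Vertex : Set where
    child       : Fin n → Vertex
    parent      : Bool → Fin n → Vertex
    grandparent : Bool → Fin n → Vertex

  data Link (tw : Fin n → Bool) : Vertex → Vertex → Set where
    child→parent       : ∀ s j → Link tw (child j) (parent s j)
    parent→grandparent : ∀ s j → Link tw (parent s j) (grandparent s j)
    parent→next        : ∀ s j → Link tw (parent s j) (grandparent (s xor tw j) (next j))

  child-injective : Injective _≡_ _≡_ child
  child-injective refl = refl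

  grandparent-injective : ∀ {s t i j} → grandparent s i ≡ grandparent t j → s ≡ t × i ≡ j
  grandparent-injective refl = refl , refl

  link? : ∀ tw → Decidable (Link tw)
  link? tw (child j) (parent s j′) with j ≟ᶠ j′
  ... | yes refl = yes (child→parent s j)
  ... | no j≢j′  = no λ { (child→parent _ _) → j≢j′ refl }
  link? tw (parent s j) (grandparent s′ j′)
    with (s Bool.≟ s′) ×-dec (j ≟ᶠ j′) | ((s xor tw j) Bool.≟ s′) ×-dec (next j ≟ᶠ j′)
  ... | yes (refl , refl) | _                 = yes (parent→grandparent s j)
  ... | no _              | yes (refl , refl) = yes (parent→next s j)
  ... | no ¬same          | no ¬next          =
    no λ { (parent→grandparent _ _) → ¬same (refl , refl) ; (parent→next _ _) → ¬next (refl , refl) }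
  link? tw (child _)         (child _)         = no λ ()
  link? tw (child _)         (grandparent _ _) = no λ ()
  link? tw (parent _ _)      (child _)         = no λ ()
  link? tw (parent _ _)      (parent _ _)      = no λ ()
  link? tw (grandparent _ _) _                 = no λ ()

  ladder-parents : ∀ tw u → (∀ v → ¬ Link tw u v)
                   ⊎ (Σ Vertex λ p → Σ Vertex λ q →
                        p ≢ q × Link tw u p × Link tw u q × (∀ v → Link tw u v → v ≡ p ⊎ v ≡ q))
  ladder-parents tw (child j) =
    inj₂ (parent false j , parent true j , (λ ()) , child→parent false j , child→parent true j ,
          λ { _ (child→parent false _) → inj₁ refl ; _ (child→parent true _) → inj₂ refl })
  ladder-parents tw (parent s j) =
    inj₂ (grandparent s j , grandparent (s xor tw j) (next j) ,
          (λ e → next≢ j (sym (proj₂ (grandparent-injective e)))) ,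
          parent→grandparent s j , parent→next s j ,
          λ { _ (parent→grandparent _ _) → inj₁ refl ; _ (parent→next _ _) → inj₂ refl })
  ladder-parents tw (grandparent _ _) = inj₁ λ _ ()

  ladder : (Fin n → Bool) → PedigreeOn n Vertex
  ladder tw = record
    { extant           = child
    ; extant-injective = child-injective
    ; Parent           = Link tw
    ; parent?          = link? tw
    ; parent-irrefl    = λ _ ()
    ; parents          = ladder-parents tw
    ; extant-childless = λ _ _ ()
    ; not-isolated     = λ
        { (child j)         → inj₁ (parent false j , child→parent false j)
        ; (parent s j)      → inj₁ (grandparent s j , parent→grandparent s j)
        ; (grandparent s j) → inj₂ (parent s j , parent→grandparent s j)
        }
    }

  enumeration : Vertex ↔ Fin (5 * n)
  enumeration = ↔-trans shape (↔-sym *↔×)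
    where
    encode : Vertex → Fin 5 × Fin n
    encode (child j)             = 0F , j
    encode (parent false j)      = 1F , j
    encode (parent true j)       = 2F , j
    encode (grandparent false j) = 3F , j
    encode (grandparent true j)  = 4F , j

    decode : Fin 5 × Fin n → Vertex
    decode (0F , j) = child j
    decode (1F , j) = parent false j
    decode (2F , j) = parent true j
    decode (3F , j) = grandparent false j
    decode (4F , j) = grandparent true j

    shape : Vertex ↔ (Fin 5 × Fin n)
    shape = mk↔ₛ′ encode decode
      (λ { (0F , _) → refl ; (1F , _) → refl ; (2F , _) → refl ; (3F , _) → refl ; (4F , _) → refl })
      (λ { (child _) → refl ; (parent false _) → refl ; (parent true _) → refl
         ; (grandparent false _) → refl ; (grandparent true _) → refl })

  -- Exchanging the two sheets over the rungs where β holds turns the tw₁-twist across rung j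
  -- (between j and next j) into the tw₂-twist.
  Relabels : (β tw₁ tw₂ : Fin n → Bool) → Fin n → Set
  Relabels β tw₁ tw₂ j = tw₁ j xor β (next j) ≡ β j xor tw₂ j

  swapAt : (Fin n → Bool) → Vertex → Vertex
  swapAt β (child j)         = child j
  swapAt β (parent s j)      = parent (s xor β j) j
  swapAt β (grandparent s j) = grandparent (s xor β j) j

  xor-twice : ∀ s b → (s xor b) xor b ≡ s
  xor-twice s b = trans (xor-assoc s b b) (trans (cong (s xor_) (xor-same b)) (xor-identityʳ s))

  swapAt-involutive : ∀ β v → swapAt β (swapAt β v) ≡ v
  swapAt-involutive β (child j)         = refl
  swapAt-involutive β (parent s j)      = cong (λ t → parent t j) (xor-twice s (β j))
  swapAt-involutive β (grandparent s j) = cong (λ t → grandparent t j) (xor-twice s (β j))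

  Avoids : Fin n → Vertex → Set
  Avoids k (child j)         = j ≢ k
  Avoids k (parent _ j)      = j ≢ k
  Avoids k (grandparent _ _) = Unit

  avoids-link : ∀ {k tw u v} → Avoids k u → Link tw u v → Avoids k v
  avoids-link j≢k (child→parent _ _)       = j≢k
  avoids-link _   (parent→grandparent _ _) = tt
  avoids-link _   (parent→next _ _)        = tt

  avoids-swapAt : ∀ {k} β {u} → Avoids k u → Avoids k (swapAt β u)
  avoids-swapAt β {child _}         a = a
  avoids-swapAt β {parent _ _}      a = a
  avoids-swapAt β {grandparent _ _} a = a

  swapAt-link : ∀ {k β tw₁ tw₂} → (∀ j → j ≢ k → Relabels β tw₁ tw₂ j)
              → ∀ {u v} → Avoids k u → Link tw₁ u v → Link tw₂ (swapAt β u) (swapAt β v)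
  swapAt-link {β = β} r _ (child→parent s j)       = child→parent (s xor β j) j
  swapAt-link {β = β} r _ (parent→grandparent s j) = parent→grandparent (s xor β j) j
  swapAt-link {β = β} {tw₁} {tw₂} r j≢k (parent→next s j) =
    subst (λ t → Link tw₂ (parent (s xor β j) j) (grandparent t (next j))) sheet (parent→next (s xor β j) j)
    where
    open ≡-Reasoning
    sheet : (s xor β j) xor tw₂ j ≡ (s xor tw₁ j) xor β (next j)
    sheet = begin
      (s xor β j) xor tw₂ j         ≡⟨ xor-assoc s (β j) (tw₂ j) ⟩
      s xor (β j xor tw₂ j)         ≡⟨ cong (s xor_) (sym (r j j≢k)) ⟩
      s xor (tw₁ j xor β (next j))  ≡⟨ sym (xor-assoc s (tw₁ j) (β (next j))) ⟩
      (s xor tw₁ j) xor β (next j)  ∎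

  last : Fin n
  last = fromℕ (2 + N)

  twisted : Fin n → Bool
  twisted j = does (j ≟ᶠ last)

  untwisted : Fin n → Bool
  untwisted _ = false

  twisted-last : twisted last ≡ true
  twisted-last = dec-true (last ≟ᶠ last) refl

  twisted-inject₁ : ∀ i → twisted (inject₁ i) ≡ false
  twisted-inject₁ i = dec-false (inject₁ i ≟ᶠ last) (fromℕ≢inject₁ ∘ sym)

  after : Fin n → Fin n → Bool
  after k j = does (k <ᶠ? j)

  after-last : ∀ {k} → k ≢ last → after k last ≡ true
  after-last {k} k≢last = dec-true (k <ᶠ? last) (≤∧≢⇒< (≤fromℕ k) k≢last)

  after-suc : ∀ {k} i → k ≢ inject₁ i → after k (suc i) ≡ after k (inject₁ i)
  after-suc {k} i k≢i =
    does-⇔ (mk⇔ (λ k<1+i → ≤∧≢⇒< (<⇒≤pred k<1+i) k≢i) (λ k<i → <-trans k<i (≤̄⇒inject₁< ≤-refl)))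
           (k <ᶠ? suc i) (k <ᶠ? inject₁ i)

  after-relabels : ∀ k j → j ≢ k
                 → Relabels (after k) twisted untwisted j × Relabels (after k) untwisted twisted j
  after-relabels k j = cases (view j)
    where
    cases : ∀ {j} → View j → j ≢ k
          → Relabels (after k) twisted untwisted j × Relabels (after k) untwisted twisted j
    cases ‵fromℕ last≢k
      rewrite next-fromℕ (2 + N) | twisted-last | after-last (last≢k ∘ sym) = refl , refl
    cases (‵inject₁ i) i≢k
      rewrite next-inject₁ i | twisted-inject₁ i | after-suc i (i≢k ∘ sym) = same , same
      where
      same : after k (inject₁ i) ≡ after k (inject₁ i) xor false
      same = sym (xor-identityʳ _)

  sub-isomorphic : ∀ {k Y} → k ∉ Y → SubIsoOn (ladder twisted) (ladder untwisted) Y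
  sub-isomorphic {k} {Y} k∉Y =
    involution⇒SubIsoOn (Avoids k) (swapAt (after k))
      (λ y y∈Y y≡k → k∉Y (subst (_∈ Y) y≡k y∈Y))
      avoids-link avoids-link (avoids-swapAt (after k)) (swapAt-involutive (after k)) (λ _ → refl)
      (swapAt-link (λ j j≢k → proj₁ (after-relabels k j j≢k)))
      (swapAt-link (λ j j≢k → proj₂ (after-relabels k j j≢k)))

  descends-from-child : ∀ {tw} v → HasDescendantIn (ladder tw) ⊤ v
  descends-from-child (child j)         = j , ∈⊤ , ε
  descends-from-child (parent s j)      = j , ∈⊤ , child→parent s j ◅ ε
  descends-from-child (grandparent s j) = j , ∈⊤ , child→parent s j ◅ parent→grandparent s j ◅ ε

  parents-of-child : ∀ {tw j w} → Link tw (child j) w → ∃ λ t → w ≡ parent t j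
  parents-of-child (child→parent t _) = t , refl

  parents-of-parent : ∀ {tw s j w} → Link tw (parent s j) w
                    → w ≡ grandparent s j ⊎ w ≡ grandparent (s xor tw j) (next j)
  parents-of-parent (parent→grandparent _ _) = inj₁ refl
  parents-of-parent (parent→next _ _)        = inj₂ refl

  module _ {tw₁ tw₂} (iso : SubIsoOn (ladder tw₁) (ladder tw₂) ⊤) where
    open SubIsoOn iso

    f-link : ∀ {u v} → Link tw₁ u v → Link tw₂ (f u) (f v)
    f-link {u} {v} = arc→ u v (descends-from-child u) (descends-from-child v)

    f-injective : ∀ {u v} → f u ≡ f v → u ≡ v
    f-injective {u} {v} fu≡fv =
      trans (sym (gf u (descends-from-child u))) (trans (cong g fu≡fv) (gf v (descends-from-child v)))

    parent-image : ∀ s j → ∃ λ t → f (parent s j) ≡ parent t j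
    parent-image s j = parents-of-child (subst (λ c → Link tw₂ c (f (parent s j))) (fixY j ∈⊤) (f-link (child→parent s j)))

    swaps : Fin n → Bool
    swaps j = proj₁ (parent-image false j)

    f-parent : ∀ s j → f (parent s j) ≡ parent (s xor swaps j) j
    f-parent false j = proj₂ (parent-image false j)
    f-parent true  j with parent-image true j
    ... | t , fp≡pt = trans fp≡pt (cong (λ t → parent t j) (¬-not t≢swaps))
      where
      t≢swaps : t ≢ swaps j
      t≢swaps t≡swaps with () ← f-injective (trans fp≡pt (trans (cong (λ t → parent t j) t≡swaps) (sym (f-parent false j))))

    image-parent-of-same-rung : ∀ j → Link tw₂ (parent (tw₁ j xor swaps (next j)) (next j))
                                                (f (grandparent (tw₁ j) (next j)))
    image-parent-of-same-rung j =
      subst (λ p → Link tw₂ p (f (grandparent (tw₁ j) (next j)))) (f-parent (tw₁ j) (next j))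
            (f-link (parent→grandparent (tw₁ j) (next j)))

    image-parent-of-previous-rung : ∀ j → Link tw₂ (parent (swaps j) j) (f (grandparent (tw₁ j) (next j)))
    image-parent-of-previous-rung j =
      subst (λ p → Link tw₂ p (f (grandparent (tw₁ j) (next j)))) (f-parent false j) (f-link (parent→next false j))

    swaps-relabels : ∀ j → Relabels swaps tw₁ tw₂ j
    swaps-relabels j with parents-of-parent (image-parent-of-same-rung j)
                           | parents-of-parent (image-parent-of-previous-rung j)
    ... | inj₁ e₁ | inj₁ e₂ = contradiction (proj₂ (grandparent-injective (trans (sym e₁) e₂))) (next≢ j)
    ... | inj₁ e₁ | inj₂ e₂ = proj₁ (grandparent-injective (trans (sym e₁) e₂))
    ... | inj₂ e₁ | inj₁ e₂ = contradiction (proj₂ (grandparent-injective (trans (sym e₁) e₂))) (next²≢ j)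
    ... | inj₂ e₁ | inj₂ e₂ = contradiction (proj₂ (grandparent-injective (trans (sym e₁) e₂))) (next≢ (next j))

  twisted-not-relabelled : ∀ σ → ¬ (∀ j → Relabels σ twisted untwisted j)
  twisted-not-relabelled σ r = not-¬ refl (sym wrap)
    where
    open ≡-Reasoning
    step : ∀ i → σ (suc i) ≡ σ (inject₁ i)
    step i = begin
      σ (suc i)                                       ≡⟨ cong σ (sym (next-inject₁ i)) ⟩
      σ (next (inject₁ i))                            ≡⟨ cong (_xor σ (next (inject₁ i))) (sym (twisted-inject₁ i)) ⟩
      twisted (inject₁ i) xor σ (next (inject₁ i))    ≡⟨ r (inject₁ i) ⟩
      σ (inject₁ i) xor false                         ≡⟨ xor-identityʳ _ ⟩
      σ (inject₁ i)                                   ∎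

    constant : ∀ j → σ j ≡ σ zero
    constant = <-weakInduction (λ j → σ j ≡ σ zero) refl (λ i σi≡σ0 → trans (step i) σi≡σ0)

    wrap : not (σ zero) ≡ σ zero
    wrap = begin
      not (σ zero)                    ≡⟨ cong (_xor σ zero) (sym twisted-last) ⟩
      twisted last xor σ zero         ≡⟨ cong (λ j → twisted last xor σ j) (sym (next-fromℕ _)) ⟩
      twisted last xor σ (next last)  ≡⟨ r last ⟩
      σ last xor false                ≡⟨ xor-identityʳ _ ⟩
      σ last                          ≡⟨ constant last ⟩
      σ zero                          ∎

  not-isomorphic : ¬ SubIsoOn (ladder twisted) (ladder untwisted) ⊤
  not-isomorphic iso = twisted-not-relabelled (swaps iso) (swaps-relabels iso)

theorem1 : ∀ (n : ℕ) → 2 < n →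
    Σ (Pedigree n) λ T → Σ (Pedigree n) λ U →
    Hypomorphic (n ∸ 1) T U × ¬ SubIso T U ⊤
theorem1 .(3 + N) (s≤s (s≤s (s≤s (z≤n {N})))) =
  toPedigree (ladder twisted) , toPedigree (ladder untwisted) , hypomorphic , not-isomorphic ∘ SubIso⇒SubIsoOn
  where
  open Ladder N
  open Enumerated enumeration

  hypomorphic : Hypomorphic (n ∸ 1) (toPedigree (ladder twisted)) (toPedigree (ladder untwisted))
  hypomorphic Y ∣Y∣≡n-1 =
    SubIsoOn⇒SubIso (sub-isomorphic (proj₂ (∣p∣<n⇒∃∉ Y (subst (_< n) (sym ∣Y∣≡n-1) ℕ.≤-refl))))
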